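{- Let $F$ be a field and let $H$ be a uniform hypergraph. Then $\mathrm{M}(H)\le \mathrm{Z}_0(H)\le \mathrm{I}(H)\le \mathrm{Z}_{pd}(H)$.
   Context: $H$ is a $d$-uniform hypergraph ($d\ge 2$) with vertex set $[n]$ and edges that are $d$-element subsets of $[n]$. A vertex $w$ is a neighbor of $v$ if some edge contains both. $\mathrm{M}(H)$: a $d$-hypermatrix $A=[a_{i_1\cdots i_d}]\in F^{n\times\cdots\times n}$ is graphical if it is symmetric under all permutations of indices and $a_{i_1\cdots i_d}=0$ whenever the indices are not all distinct; $\mathcal{S}(H)$ is the set of graphical $A$ with $a_{i_1\cdots i_d}\ne0$ iff $\{i_1,\dots,i_d\}\in E(H)$. $x\in F^n$ is a null vector of $A$ if $\sum_{j=1}^n a_{i_1\cdots i_{d-1}j}x_j=0$ for all $(i_1,\dots,i_{d-1})\in[n]^{d-1}$; $\operatorname{null}A$ is the dimension of the space of null vectors, and $\mathrm{M}(H)=\max\{\operatorname{null}A:A\in\mathcal{S}(H)\}$. $\mathrm{Z}_0(H)$: with a set $B$ initially blue (others white), a set $S$ of $d-1$ distinct vertices (not necessarily blue) can turn a white vertex $w$ blue if $S\cup\{w\}\in E(H)$ and every white $u$ with $S\cup\{u\}\in E(H)$ equals $w$. $B$ is a zero forcing set if repeated application colors all vertices blue; $\mathrm{Z}_0(H)$ is the minimum size of such $B$. $\mathrm{I}(H)$: with $B$ initially infected, a nonempty set $S$ of infected vertices can infect all other vertices of an edge $e$ if $S\subset e$ and for every uninfected $u\notin e$ no edge contains $S\cup\{u\}$.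 $\mathrm{I}(H)$ is the minimum size of a set $B$ from which repeated application infects all vertices. $\mathrm{Z}_{pd}(H)$: with $B$ initially blue, if all white neighbors of a blue vertex $v$ lie in one edge containing $v$, they all become blue. $\mathrm{Z}_{pd}(H)$ is the minimum size of a set $B$ from which repeated application colors all vertices blue. -}

module Defs where

open import Level using (Level; _⊔_)
open import Data.Nat as ℕ using (ℕ; zero; suc; _≤_)
open import Data.Fin using (Fin; zero; suc)
open import Data.Fin.Properties using (any?; _≟_)
open import Data.Fin.Subset as Sub using (Subset; ⁅_⁆; _∪_; _⊆_; ∣_∣; Nonempty)
open import Data.Fin.Permutation using (Permutation′; _⟨$⟩ʳ_)
open import Data.Vec using (tabulate)
open import Data.List using (List)
open import Data.List.Membership.Propositional using () renaming (_∈_ to _∈ₗ_)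
open import Data.Product using (Σ; ∃; _×_; _,_)
open import Function using (_∘_)
open import Relation.Nullary using (¬_; does)
open import Relation.Binary.PropositionalEquality using (_≡_; _≢_)
open import Algebra.Bundles using (CommutativeRing)

record Field (c ℓ : Level) : Set (Level.suc (c ⊔ ℓ)) where
  field
    commutativeRing : CommutativeRing c ℓ
  open CommutativeRing commutativeRing public
  field
    1≉0     : ¬ (1# ≈ 0#)
    inverse : ∀ x → ¬ (x ≈ 0#) → ∃ λ y → (x * y) ≈ 1#

-- d-uniform hypergraphs on vertex set Fin n.  The edge set is given as
-- a list of subsets of Fin n (duplicates are harmless), each of size d.

record Hypergraph (n d : ℕ) : Set where
  field
    edges   : List (Subset n)
    uniform : ∀ {e} → e ∈ₗ edges → ∣ e ∣ ≡ d

open Hypergraph public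

module _ {n d : ℕ} (H : Hypergraph n d) where

  IsEdge : Subset n → Set
  IsEdge e = e ∈ₗ edges H

  Neighbor : Fin n → Fin n → Set
  Neighbor v w = w ≢ v × ∃ λ e → IsEdge e × (v Sub.∈ e) × (w Sub.∈ e)

image : ∀ {d n} → (Fin d → Fin n) → Subset n
image i = tabulate (λ v → does (any? (λ j → i j ≟ v)))

snoc : ∀ {a} {A : Set a} {k} → (Fin k → A) → A → Fin (suc k) → A
snoc {k = zero}  i a _       = a
snoc {k = suc k} i a zero    = i zero
snoc {k = suc k} i a (suc f) = snoc (i ∘ suc) a f

module FieldDefs {c ℓ} (F : Field c ℓ) where
  open Field F using (Carrier; _≈_; _+_; _*_; 0#; 1#)

  Σ[_] : ∀ {n} → (Fin n → Carrier) → Carrier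
  Σ[_] {zero}  f = 0#
  Σ[_] {suc n} f = f zero + Σ[ f ∘ suc ]

  HyperMatrix : ℕ → ℕ → Set c
  HyperMatrix d n = (Fin d → Fin n) → Carrier

  IsGraphical : ∀ {d n} → HyperMatrix d n → Set ℓ
  IsGraphical {d} {n} A =
    (∀ (σ : Permutation′ d) (i : Fin d → Fin n) → A (i ∘ (σ ⟨$⟩ʳ_)) ≈ A i) ×
    (∀ (i : Fin d → Fin n) → (Σ (Fin d) λ j → Σ (Fin d) λ j′ → j ≢ j′ × i j ≡ i j′) → A i ≈ 0#)

  InS : ∀ {n d} → Hypergraph n d → HyperMatrix d n → Set ℓ
  InS H A = IsGraphical A ×
    (∀ i → (¬ (A i ≈ 0#) → IsEdge H (image i)) × (IsEdge H (image i) → ¬ (A i ≈ 0#)))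

  IsNullVector : ∀ {k n} → HyperMatrix (suc k) n → (Fin n → Carrier) → Set ℓ
  IsNullVector {k} {n} A x = ∀ (i : Fin k → Fin n) → Σ[ (λ j → A (snoc i j) * x j) ] ≈ 0#

  LinearlyIndependent : ∀ {m n} → (Fin m → Fin n → Carrier) → Set (c ⊔ ℓ)
  LinearlyIndependent {m} x =
    ∀ (a : Fin m → Carrier) → (∀ v → Σ[ (λ l → a l * x l v) ] ≈ 0#) → ∀ l → a l ≈ 0#

-- ZBlue H B is the set
-- of vertices eventually coloured blue from B (least set closed under
-- the forcing rule; "white" = not (yet) in the closure).

data ZBlue {n k} (H : Hypergraph n (suc k)) (B : Subset n) : Fin n → Set where
  initial : ∀ {v} → v Sub.∈ B → ZBlue H B v
  force   : ∀ (S : Subset n) (w : Fin n) →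
            ∣ S ∣ ≡ k →
            IsEdge H (S ∪ ⁅ w ⁆) →
            (∀ u → IsEdge H (S ∪ ⁅ u ⁆) → u ≢ w → ZBlue H B u) →
            ZBlue H B w

IsZeroForcingSet : ∀ {n k} → Hypergraph n (suc k) → Subset n → Set
IsZeroForcingSet H B = ∀ v → ZBlue H B v

data Infected {n d} (H : Hypergraph n d) (B : Subset n) : Fin n → Set where
  initial : ∀ {v} → v Sub.∈ B → Infected H B v
  infect  : ∀ (S e : Subset n) →
            Nonempty S →
            (∀ s → s Sub.∈ S → Infected H B s) →
            IsEdge H e →
            S ⊆ e →
            (∀ u → u Sub.∉ e → (∃ λ e′ → IsEdge H e′ × S ⊆ e′ × u Sub.∈ e′) → Infected H B u) →
            ∀ w → w Sub.∈ e → Infected H B w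

IsInfectingSet : ∀ {n d} → Hypergraph n d → Subset n → Set
IsInfectingSet H B = ∀ v → Infected H B v

data PdBlue {n d} (H : Hypergraph n d) (B : Subset n) : Fin n → Set where
  initial : ∀ {v} → v Sub.∈ B → PdBlue H B v
  force   : ∀ (v : Fin n) (e : Subset n) →
            PdBlue H B v →
            IsEdge H e →
            v Sub.∈ e →
            (∀ u → Neighbor H v u → u Sub.∉ e → PdBlue H B u) →
            ∀ w → w Sub.∈ e → PdBlue H B w

IsPdSet : ∀ {n d} → Hypergraph n d → Subset n → Set
IsPdSet H B = ∀ v → PdBlue H B v

-- A null vector y of A ∈ S(H) that vanishes on B vanishes on every vertex w that B forces: in the
-- null-vector equation at an index tuple enumerating the forcing set S, each term for j ≠ w is zero
-- (y j = 0 if S ∪ {j} is an edge, the entry of A is 0 otherwise), while the entry for w is nonzero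
-- because S ∪ {w} is an edge. So when B is a zero forcing set, a combination of independent null
-- vectors that vanishes on B is zero; as more than ∣ B ∣ vectors are dependent on the coordinates
-- in B, there are at most ∣ B ∣ of them. The other two inequalities hold with the same set:
-- infecting an edge e from S is simulated by the forces (e − w) → w for w ∈ e − S, and a
-- power-domination step from v into e is the infection step from {v}.

module Submission where

open import Defs
open import Level using (Level; _⊔_)
open import Function using (_∘_)
open import Data.Nat using (ℕ; zero; suc; _≤_; _<_; _≤?_; s≤s)
open import Data.Nat.Properties using (≤-refl; suc-injective; 1+n≢n; m≤n⇒m≤1+n; ≰⇒>)
open import Data.Bool using (true; false)
open import Data.Fin using (Fin; zero; suc; fromℕ; inject₁; punchIn)
open import Data.Fin.Properties using (any?; _≟_; punchInᵢ≢i)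
open import Data.Fin.Subset using (Subset; _∈_; _∉_; _∪_; ⁅_⁆; _-_; _⊆_; ∣_∣)
open import Data.Fin.Subset.Properties
  using (⊆-antisym; ⊆-refl; p⊆p∪q; q⊆p∪q; x∈p∪q⁻; x∈⁅x⁆; x∈⁅y⁆⇒x≡y; x≢y⇒x∉⁅y⁆; p─⊥≡p; x∈p∧x∉q⇒x∈p─q; p─q⊆p; _∈?_)
open import Data.Vec using (_∷_; here; there)
open import Data.Vec.Properties using (lookup⇒[]=; []=⇒lookup; lookup∘tabulate)
open import Data.Vec.Functional using (insertAt)
open import Data.Vec.Functional.Properties using (insertAt-lookup; insertAt-punchIn)
open import Data.Product using (Σ; ∃; _×_; _,_; proj₁; proj₂)
open import Data.Sum using (_⊎_; inj₁; inj₂; [_,_])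
open import Data.Empty using (⊥; ⊥-elim)
open import Relation.Nullary using (¬_; Dec; yes; no; ¬?; ¬¬-map; contradiction)
open import Relation.Nullary.Decidable using (dec-true; decidable-stable; ¬¬-excluded-middle)
open import Relation.Binary.PropositionalEquality as ≡ using (_≡_; _≢_; refl; subst)

¬¬-pull-Fin : ∀ {p n} {P : Fin n → Set p} → (∀ i → ¬ ¬ P i) → ¬ ¬ (∀ i → P i)
¬¬-pull-Fin {n = zero}  _ k = k λ ()
¬¬-pull-Fin {n = suc n} h k = h zero λ p₀ → ¬¬-pull-Fin (h ∘ suc) λ ps → k λ { zero → p₀ ; (suc i) → ps i }

¬¬-pull-→ : ∀ {a b} {A : Set a} {B : Set b} → (A → ¬ ¬ B) → ¬ ¬ (A → B)
¬¬-pull-→ f k = k λ a → ⊥-elim (f a λ b → k λ _ → b)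

module _ {n : ℕ} where

  ∪-⊆ : {p q r : Subset n} → p ⊆ r → q ⊆ r → p ∪ q ⊆ r
  ∪-⊆ {p} {q} p⊆r q⊆r x∈p∪q = [ p⊆r , q⊆r ] (x∈p∪q⁻ p q x∈p∪q)

  x∈p⇒⁅x⁆⊆p : ∀ {x} {p : Subset n} → x ∈ p → ⁅ x ⁆ ⊆ p
  x∈p⇒⁅x⁆⊆p {x} x∈p y∈⁅x⁆ = subst (_∈ _) (≡.sym (x∈⁅y⁆⇒x≡y x y∈⁅x⁆)) x∈p

  x∈p⇒p∪⁅x⁆≡p : ∀ {x} {p : Subset n} → x ∈ p → p ∪ ⁅ x ⁆ ≡ p
  x∈p⇒p∪⁅x⁆≡p x∈p = ⊆-antisym (∪-⊆ ⊆-refl (x∈p⇒⁅x⁆⊆p x∈p)) (p⊆p∪q _)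

  x∈p⇒p-x∪⁅x⁆≡p : ∀ {x} {p : Subset n} → x ∈ p → (p - x) ∪ ⁅ x ⁆ ≡ p
  x∈p⇒p-x∪⁅x⁆≡p {x} {p} x∈p = ⊆-antisym (∪-⊆ (p─q⊆p p ⁅ x ⁆) (x∈p⇒⁅x⁆⊆p x∈p)) p⊆p-x∪⁅x⁆
    where
    p⊆p-x∪⁅x⁆ : p ⊆ (p - x) ∪ ⁅ x ⁆
    p⊆p-x∪⁅x⁆ {y} y∈p with y ≟ x
    ... | yes refl = q⊆p∪q (p - x) ⁅ x ⁆ (x∈⁅x⁆ x)
    ... | no y≢x   = p⊆p∪q ⁅ x ⁆ (x∈p∧x∉q⇒x∈p─q y∈p (x≢y⇒x∉⁅y⁆ y≢x))

x∈p⇒suc∣p-x∣≡∣p∣ : ∀ {n} {x : Fin n} {p : Subset n} → x ∈ p → suc ∣ p - x ∣ ≡ ∣ p ∣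
x∈p⇒suc∣p-x∣≡∣p∣ {x = zero}  {true ∷ p}  here        = ≡.cong (suc ∘ ∣_∣) (p─⊥≡p p)
x∈p⇒suc∣p-x∣≡∣p∣ {x = suc x} {true ∷ p}  (there x∈p) = ≡.cong suc (x∈p⇒suc∣p-x∣≡∣p∣ x∈p)
x∈p⇒suc∣p-x∣≡∣p∣ {x = suc x} {false ∷ p} (there x∈p) = x∈p⇒suc∣p-x∣≡∣p∣ x∈p

∈-image⁺ : ∀ {d n} (i : Fin d → Fin n) {v} j → i j ≡ v → v ∈ image i
∈-image⁺ i {v} j ij≡v = lookup⇒[]= v _ (≡.trans (lookup∘tabulate _ v) (dec-true (any? (λ j → i j ≟ v)) (j , ij≡v)))

∈-image⁻ : ∀ {d n} (i : Fin d → Fin n) {v} → v ∈ image i → ∃ λ j → i j ≡ v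
∈-image⁻ i {v} v∈i with any? (λ j → i j ≟ v) | ≡.trans (≡.sym (lookup∘tabulate _ v)) ([]=⇒lookup v∈i)
... | yes ∃j | _ = ∃j
... | no _   | ()

module _ {n : ℕ} where

  snoc-last : ∀ {k} (i : Fin k → Fin n) a → snoc i a (fromℕ k) ≡ a
  snoc-last {zero}  i a = refl
  snoc-last {suc k} i a = snoc-last (i ∘ suc) a

  snoc-inject₁ : ∀ {k} (i : Fin k → Fin n) a j → snoc i a (inject₁ j) ≡ i j
  snoc-inject₁ {suc k} i a zero    = refl
  snoc-inject₁ {suc k} i a (suc j) = snoc-inject₁ (i ∘ suc) a j

  snoc-cases : ∀ {k} (i : Fin k → Fin n) a t → snoc i a t ≡ a ⊎ ∃ λ j → snoc i a t ≡ i j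
  snoc-cases {zero}  i a t       = inj₁ refl
  snoc-cases {suc k} i a zero    = inj₂ (zero , refl)
  snoc-cases {suc k} i a (suc t) with snoc-cases (i ∘ suc) a t
  ... | inj₁ eq       = inj₁ eq
  ... | inj₂ (j , eq) = inj₂ (suc j , eq)

  image-snoc : ∀ {k} (i : Fin k → Fin n) a → image (snoc i a) ≡ image i ∪ ⁅ a ⁆
  image-snoc i a = ⊆-antisym forward backward
    where
    forward : image (snoc i a) ⊆ image i ∪ ⁅ a ⁆
    forward v∈ with ∈-image⁻ (snoc i a) v∈
    ... | t , refl with snoc-cases i a t
    ...   | inj₁ eq       = q⊆p∪q (image i) ⁅ a ⁆ (subst (_∈ ⁅ a ⁆) (≡.sym eq) (x∈⁅x⁆ a))
    ...   | inj₂ (j , eq) = p⊆p∪q ⁅ a ⁆ (∈-image⁺ i j (≡.sym eq))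
    backward : image i ∪ ⁅ a ⁆ ⊆ image (snoc i a)
    backward {v} v∈ with x∈p∪q⁻ (image i) ⁅ a ⁆ v∈
    ... | inj₁ v∈i with ∈-image⁻ i v∈i
    ...   | j , eq = ∈-image⁺ (snoc i a) (inject₁ j) (≡.trans (snoc-inject₁ i a j) eq)
    backward {v} v∈ | inj₂ v∈⁅a⁆ = ∈-image⁺ (snoc i a) (fromℕ _) (≡.trans (snoc-last i a) (≡.sym (x∈⁅y⁆⇒x≡y a v∈⁅a⁆)))

enumerate : ∀ {n} (S : Subset n) → Fin ∣ S ∣ → Fin n
enumerate (true  ∷ S) zero    = zero
enumerate (true  ∷ S) (suc j) = suc (enumerate S j)
enumerate (false ∷ S) j       = suc (enumerate S j)

enumerate-∈ : ∀ {n} (S : Subset n) j → enumerate S j ∈ S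
enumerate-∈ (true  ∷ S) zero    = here
enumerate-∈ (true  ∷ S) (suc j) = there (enumerate-∈ S j)
enumerate-∈ (false ∷ S) j       = there (enumerate-∈ S j)

enumerate-surjective : ∀ {n} (S : Subset n) {v} → v ∈ S → ∃ λ j → enumerate S j ≡ v
enumerate-surjective (true ∷ S) here = zero , refl
enumerate-surjective (true ∷ S) (there v∈S) with enumerate-surjective S v∈S
... | j , eq = suc j , ≡.cong suc eq
enumerate-surjective (false ∷ S) (there v∈S) with enumerate-surjective S v∈S
... | j , eq = j , ≡.cong suc eq

image-enumerate : ∀ {n} (S : Subset n) → image (enumerate S) ≡ S
image-enumerate S = ⊆-antisym forward backward
  where
  forward : image (enumerate S) ⊆ S
  forward v∈ with ∈-image⁻ (enumerate S) v∈
  ... | j , refl = enumerate-∈ S j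
  backward : S ⊆ image (enumerate S)
  backward v∈S with enumerate-surjective S v∈S
  ... | j , eq = ∈-image⁺ (enumerate S) j eq

∣S∣≡k⇒S≡image : ∀ {n k} (S : Subset n) → ∣ S ∣ ≡ k → Σ (Fin k → Fin n) λ i → image i ≡ S
∣S∣≡k⇒S≡image S refl = enumerate S , image-enumerate S

Infected⇒ZBlue : ∀ {n k} {H : Hypergraph n (suc k)} {B v} → Infected H B v → ZBlue H B v
Infected⇒ZBlue (initial v∈B) = initial v∈B
Infected⇒ZBlue {k = k} {H} {B} (infect S e _ S-infected e-edge S⊆e outer-infected w w∈e) with w ∈? S
... | yes w∈S = Infected⇒ZBlue (S-infected w w∈S)
... | no  w∉S = force (e - w) w ∣e-w∣≡k (subst (IsEdge H) (≡.sym (x∈p⇒p-x∪⁅x⁆≡p w∈e)) e-edge) others-blue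
  where
  ∣e-w∣≡k : ∣ e - w ∣ ≡ k
  ∣e-w∣≡k = suc-injective (≡.trans (x∈p⇒suc∣p-x∣≡∣p∣ w∈e) (uniform H e-edge))

  S⊆e-w : S ⊆ e - w
  S⊆e-w x∈S = x∈p∧x∉q⇒x∈p─q (S⊆e x∈S) (x≢y⇒x∉⁅y⁆ λ { refl → w∉S x∈S })

  others-blue : ∀ u → IsEdge H ((e - w) ∪ ⁅ u ⁆) → u ≢ w → ZBlue H B u
  others-blue u edge u≢w with u ∈? e
  ... | yes u∈e = contradiction (≡.trans (≡.sym ∣e-w∣≡k) ∣e-w∣≡1+k) (1+n≢n ∘ ≡.sym)
    where
    ∣e-w∣≡1+k : ∣ e - w ∣ ≡ suc k
    ∣e-w∣≡1+k = subst (λ f → ∣ f ∣ ≡ suc k) (x∈p⇒p∪⁅x⁆≡p (x∈p∧x∉q⇒x∈p─q u∈e (x≢y⇒x∉⁅y⁆ u≢w))) (uniform H edge)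
  ... | no  u∉e = Infected⇒ZBlue (outer-infected u u∉e
                    (_ , edge , p⊆p∪q ⁅ u ⁆ ∘ S⊆e-w , q⊆p∪q (e - w) ⁅ u ⁆ (x∈⁅x⁆ u)))

PdBlue⇒Infected : ∀ {n d} {H : Hypergraph n d} {B v} → PdBlue H B v → Infected H B v
PdBlue⇒Infected (initial v∈B) = initial v∈B
PdBlue⇒Infected {H = H} {B} (force v e v-blue e-edge v∈e neighbours-blue w w∈e) =
  infect ⁅ v ⁆ e (v , x∈⁅x⁆ v) ⁅v⁆-infected e-edge (x∈p⇒⁅x⁆⊆p v∈e) outer-infected w w∈e
  where
  ⁅v⁆-infected : ∀ s → s ∈ ⁅ v ⁆ → Infected H B s
  ⁅v⁆-infected s s∈⁅v⁆ rewrite x∈⁅y⁆⇒x≡y v s∈⁅v⁆ = PdBlue⇒Infected v-blue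

  outer-infected : ∀ u → u ∉ e → (∃ λ e′ → IsEdge H e′ × ⁅ v ⁆ ⊆ e′ × u ∈ e′) → Infected H B u
  outer-infected u u∉e (e′ , e′-edge , ⁅v⁆⊆e′ , u∈e′) =
    PdBlue⇒Infected (neighbours-blue u (u≢v , e′ , e′-edge , ⁅v⁆⊆e′ (x∈⁅x⁆ v) , u∈e′) u∉e)
    where
    u≢v : u ≢ v
    u≢v refl = u∉e v∈e

module _ {c ℓ} (F : Field c ℓ) where
  open Field F hiding (zero)
  open FieldDefs F
  open import Algebra.Properties.Semiring.Sum semiring
    using (sum; sum-cong-≋; sum-replicate-zero; sum-remove; ∑-distrib-+; ∑-comm; *-distribˡ-sum; *-distribʳ-sum)
  open import Algebra.Properties.Ring ring using (-‿distribˡ-*)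
  open import Relation.Binary.Reasoning.Setoid setoid
  open import Algebra.Properties.CommutativeSemigroup *-commutativeSemigroup using (xy∙z≈y∙xz; x∙yz≈y∙xz)

  x≉0∧x*y≈0⇒y≈0 : ∀ {x y} → ¬ x ≈ 0# → x * y ≈ 0# → y ≈ 0#
  x≉0∧x*y≈0⇒y≈0 {x} {y} x≉0 xy≈0 with inverse x x≉0
  ... | x⁻¹ , xx⁻¹≈1 = begin
    y                ≈⟨ *-identityˡ y ⟨
    1# * y           ≈⟨ *-congʳ (trans (*-comm x⁻¹ x) xx⁻¹≈1) ⟨
    (x⁻¹ * x) * y    ≈⟨ *-assoc x⁻¹ x y ⟩
    x⁻¹ * (x * y)    ≈⟨ *-congˡ xy≈0 ⟩
    x⁻¹ * 0#         ≈⟨ zeroʳ x⁻¹ ⟩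
    0#               ∎

  -- Σ[_] from Defs recurses on n like the library's sum but is not definitionally equal to it
  -- for variable n; the library's lemmas are transported along this equation.
  Σ≡sum : ∀ {n} (f : Fin n → Carrier) → Σ[ f ] ≡ sum f
  Σ≡sum {zero}  f = ≡.refl
  Σ≡sum {suc n} f = ≡.cong (f zero +_) (Σ≡sum (f ∘ suc))

  Σ-cong : ∀ {n} {f g : Fin n → Carrier} → (∀ i → f i ≈ g i) → Σ[ f ] ≈ Σ[ g ]
  Σ-cong {f = f} {g} f≈g rewrite Σ≡sum f | Σ≡sum g = sum-cong-≋ f≈g

  Σ-zero : ∀ {n} {f : Fin n → Carrier} → (∀ i → f i ≈ 0#) → Σ[ f ] ≈ 0#
  Σ-zero {n} {f} f≈0 rewrite Σ≡sum f = trans (sum-cong-≋ f≈0) (sum-replicate-zero n)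

  Σ-remove : ∀ {n} (i : Fin (suc n)) (f : Fin (suc n) → Carrier) → Σ[ f ] ≈ f i + Σ[ f ∘ punchIn i ]
  Σ-remove i f rewrite Σ≡sum f | Σ≡sum (f ∘ punchIn i) = sum-remove f

  Σ-distrib-+ : ∀ {n} (f g : Fin n → Carrier) → Σ[ (λ i → f i + g i) ] ≈ Σ[ f ] + Σ[ g ]
  Σ-distrib-+ f g rewrite Σ≡sum (λ i → f i + g i) | Σ≡sum f | Σ≡sum g = ∑-distrib-+ f g

  *-distribˡ-Σ : ∀ {n} x (f : Fin n → Carrier) → x * Σ[ f ] ≈ Σ[ (λ i → x * f i) ]
  *-distribˡ-Σ x f rewrite Σ≡sum f | Σ≡sum (λ i → x * f i) = *-distribˡ-sum x f

  *-distribʳ-Σ : ∀ {n} x (f : Fin n → Carrier) → Σ[ f ] * x ≈ Σ[ (λ i → f i * x) ]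
  *-distribʳ-Σ x f rewrite Σ≡sum f | Σ≡sum (λ i → f i * x) = *-distribʳ-sum x f

  Σ-comm : ∀ {m n} (f : Fin m → Fin n → Carrier) → Σ[ (λ i → Σ[ f i ]) ] ≈ Σ[ (λ j → Σ[ (λ i → f i j) ]) ]
  Σ-comm f = begin
    Σ[ (λ i → Σ[ f i ]) ]                 ≈⟨ Σ-cong (λ i → reflexive (Σ≡sum (f i))) ⟩
    Σ[ (λ i → sum (f i)) ]                ≡⟨ Σ≡sum (λ i → sum (f i)) ⟩
    sum (λ i → sum (f i))                 ≈⟨ ∑-comm f ⟩
    sum (λ j → sum (λ i → f i j))         ≡⟨ Σ≡sum (λ j → sum (λ i → f i j)) ⟨
    Σ[ (λ j → sum (λ i → f i j)) ]        ≈⟨ Σ-cong (λ j → reflexive (Σ≡sum (λ i → f i j))) ⟨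
    Σ[ (λ j → Σ[ (λ i → f i j) ]) ]       ∎

  Σ-single : ∀ {n} (w : Fin n) {f : Fin n → Carrier} → (∀ j → j ≢ w → f j ≈ 0#) → Σ[ f ] ≈ f w
  Σ-single {suc n} w {f} f≈0 = begin
    Σ[ f ]                   ≈⟨ Σ-remove w f ⟩
    f w + Σ[ f ∘ punchIn w ] ≈⟨ +-congˡ (Σ-zero (λ j → f≈0 (punchIn w j) (punchInᵢ≢i w j))) ⟩
    f w + 0#                 ≈⟨ +-identityʳ (f w) ⟩
    f w                      ∎

  combination : ∀ {m b} → (Fin m → Carrier) → (Fin m → Fin b → Carrier) → Fin b → Carrier
  combination a r v = Σ[ (λ l → a l * r l v) ]

  -- Equality in F is not decidable, so Gaussian elimination can only ask whether an entry is zero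
  -- under double negation; this suffices because the dimension bound m ≤ ∣ B ∣ is decidable.
  WeaklyIndependent : ∀ {m b} → (Fin m → Fin b → Carrier) → Set (c ⊔ ℓ)
  WeaklyIndependent r = ∀ a → (∀ v → combination a r v ≈ 0#) → ∀ l → ¬ ¬ (a l ≈ 0#)

  weaklyIndependent-dropColumn : ∀ {m b} (r : Fin m → Fin (suc b) → Carrier) → (∀ l → r l zero ≈ 0#) →
                                 WeaklyIndependent r → WeaklyIndependent (λ l → r l ∘ suc)
  weaklyIndependent-dropColumn r r₀≈0 r-indep a a·r≈0 = r-indep a λ where
    zero    → Σ-zero (λ l → trans (*-congˡ (r₀≈0 l)) (zeroʳ (a l)))
    (suc v) → a·r≈0 v

  rowReduce : ∀ {m b} → (Fin (suc m) → Fin (suc b) → Carrier) → Fin (suc m) → Fin m → Fin (suc b) → Carrier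
  rowReduce r p l v = r p zero * r (punchIn p l) v + (- r (punchIn p l) zero) * r p v

  rowReduce-column₀≈0 : ∀ {m b} (r : Fin (suc m) → Fin (suc b) → Carrier) p l → rowReduce r p l zero ≈ 0#
  rowReduce-column₀≈0 r p l = begin
    q * x + (- x) * q    ≈⟨ +-congˡ (-‿distribˡ-* x q) ⟨
    q * x + - (x * q)    ≈⟨ +-congˡ (-‿cong (*-comm x q)) ⟩
    q * x + - (q * x)    ≈⟨ -‿inverseʳ (q * x) ⟩
    0#                   ∎
    where
    q x : Carrier
    q = r p zero
    x = r (punchIn p l) zero

  liftCoefficients : ∀ {m b} → (Fin (suc m) → Fin (suc b) → Carrier) → Fin (suc m) → (Fin m → Carrier) → Fin (suc m) → Carrier
  liftCoefficients r p a = insertAt (λ l → r p zero * a l) p Σ[ (λ l → a l * - r (punchIn p l) zero) ]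

  combination-rowReduce : ∀ {m b} (r : Fin (suc m) → Fin (suc b) → Carrier) p (a : Fin m → Carrier) v →
    combination (liftCoefficients r p a) r v ≈ combination a (rowReduce r p) v
  combination-rowReduce {m} r p a v = begin
    combination a′ r v                                             ≈⟨ Σ-remove p (λ l → a′ l * r l v) ⟩
    a′ p * R + Σ[ (λ l → a′ (punchIn p l) * x l) ]
      ≈⟨ +-cong (*-congʳ (reflexive (insertAt-lookup _ p t)))
                (Σ-cong (λ l → *-congʳ (reflexive (insertAt-punchIn _ p t l)))) ⟩
    t * R + Σ[ (λ l → (q * a l) * x l) ]                           ≈⟨ +-congʳ (*-distribʳ-Σ R (λ l → a l * y l)) ⟩
    Σ[ (λ l → (a l * y l) * R) ] + Σ[ (λ l → (q * a l) * x l) ]    ≈⟨ Σ-distrib-+ (λ l → (a l * y l) * R) (λ l → (q * a l) * x l) ⟨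
    Σ[ (λ l → (a l * y l) * R + (q * a l) * x l) ]                 ≈⟨ Σ-cong (λ l → regroup (a l) (y l) (x l)) ⟩
    combination a (rowReduce r p) v                                ∎
    where
    q R : Carrier
    q = r p zero
    R = r p v
    x y : Fin m → Carrier
    x l = r (punchIn p l) v
    y l = - r (punchIn p l) zero
    t : Carrier
    t = Σ[ (λ l → a l * y l) ]
    a′ : Fin (suc m) → Carrier
    a′ = liftCoefficients r p a
    regroup : ∀ α β γ → (α * β) * R + (q * α) * γ ≈ α * (q * γ + β * R)
    regroup α β γ = begin
      (α * β) * R + (q * α) * γ   ≈⟨ +-comm _ _ ⟩
      (q * α) * γ + (α * β) * R   ≈⟨ +-cong (xy∙z≈y∙xz q α γ) (*-assoc α β R) ⟩
      α * (q * γ) + α * (β * R)   ≈⟨ distribˡ α _ _ ⟨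
      α * (q * γ + β * R)         ∎

  weaklyIndependent-rowReduce : ∀ {m b} (r : Fin (suc m) → Fin (suc b) → Carrier) p → ¬ r p zero ≈ 0# →
                                WeaklyIndependent r → WeaklyIndependent (rowReduce r p)
  weaklyIndependent-rowReduce r p rp₀≉0 r-indep a a·r′≈0 l =
    ¬¬-map (x≉0∧x*y≈0⇒y≈0 rp₀≉0 ∘ trans (reflexive (≡.sym (insertAt-punchIn _ p _ l))))
      (r-indep (liftCoefficients r p a) (λ v → trans (combination-rowReduce r p a v) (a·r′≈0 v)) (punchIn p l))

  ¬weaklyIndependent : ∀ {m b} → b < m → (r : Fin m → Fin b → Carrier) → ¬ WeaklyIndependent r
  ¬weaklyIndependent {suc m} {zero}  _         r r-indep = r-indep (λ _ → 1#) (λ ()) zero 1≉0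
  ¬weaklyIndependent {suc m} {suc b} (s≤s b<m) r r-indep =
    ¬¬-pull-Fin (λ l → ¬¬-excluded-middle) eliminateColumn₀
    where
    eliminateColumn₀ : (∀ l → Dec (r l zero ≈ 0#)) → ⊥
    eliminateColumn₀ r₀≈0? with any? (λ l → ¬? (r₀≈0? l))
    ... | yes (p , rp₀≉0) =
      ¬weaklyIndependent b<m (λ l → rowReduce r p l ∘ suc)
        (weaklyIndependent-dropColumn (rowReduce r p) (rowReduce-column₀≈0 r p)
          (weaklyIndependent-rowReduce r p rp₀≉0 r-indep))
    ... | no ∄pivot =
      ¬weaklyIndependent (m≤n⇒m≤1+n b<m) (λ l → r l ∘ suc)
        (weaklyIndependent-dropColumn r (λ l → decidable-stable (r₀≈0? l) (∄pivot ∘ (l ,_))) r-indep)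

  combination-null : ∀ {m n k} {A : HyperMatrix (suc k) n} (a : Fin m → Carrier) (x : Fin m → Fin n → Carrier) →
                     (∀ l → IsNullVector A (x l)) → IsNullVector A (combination a x)
  combination-null {A = A} a x x-null i = begin
    Σ[ (λ j → A (snoc i j) * Σ[ (λ l → a l * x l j) ]) ]    ≈⟨ Σ-cong (λ j → *-distribˡ-Σ (A (snoc i j)) (λ l → a l * x l j)) ⟩
    Σ[ (λ j → Σ[ (λ l → A (snoc i j) * (a l * x l j)) ]) ]  ≈⟨ Σ-comm (λ j l → A (snoc i j) * (a l * x l j)) ⟩
    Σ[ (λ l → Σ[ (λ j → A (snoc i j) * (a l * x l j)) ]) ]  ≈⟨ Σ-cong (λ l → Σ-cong (λ j → x∙yz≈y∙xz (A (snoc i j)) (a l) (x l j))) ⟩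
    Σ[ (λ l → Σ[ (λ j → a l * (A (snoc i j) * x l j)) ]) ]  ≈⟨ Σ-cong (λ l → *-distribˡ-Σ (a l) (λ j → A (snoc i j) * x l j)) ⟨
    Σ[ (λ l → a l * Σ[ (λ j → A (snoc i j) * x l j) ]) ]    ≈⟨ Σ-zero (λ l → trans (*-congˡ (x-null l i)) (zeroʳ (a l))) ⟩
    0#                                                       ∎

  module _ {n k : ℕ} (H : Hypergraph n (suc k)) where

    module _ {A : HyperMatrix (suc k) n} (A∈S : InS H A) {y : Fin n → Carrier} (y-null : IsNullVector A y)
             {B : Subset n} (y|B≈0 : ∀ v → v ∈ B → y v ≈ 0#) where

      ZBlue⇒¬¬y≈0 : ∀ {v} → ZBlue H B v → ¬ ¬ (y v ≈ 0#)
      ZBlue⇒¬¬y≈0 (initial v∈B) y≉0 = y≉0 (y|B≈0 _ v∈B)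
      ZBlue⇒¬¬y≈0 (force S w ∣S∣≡k S∪w-edge others-blue) with ∣S∣≡k⇒S≡image S ∣S∣≡k
      ... | i , refl = ¬¬-map (λ off-w≈0 → x≉0∧x*y≈0⇒y≈0 Aiw≉0 (trans (sym (Σ-single w off-w≈0)) (y-null i)))
                              (¬¬-pull-Fin (λ j → ¬¬-pull-→ (term-vanishes j)))
        where
        Aiw≉0 : ¬ A (snoc i w) ≈ 0#
        Aiw≉0 = proj₂ (proj₂ A∈S (snoc i w)) (subst (IsEdge H) (≡.sym (image-snoc i w)) S∪w-edge)

        term-vanishes : ∀ j → j ≢ w → ¬ ¬ (A (snoc i j) * y j ≈ 0#)
        term-vanishes j j≢w term≉0 = ¬¬-excluded-middle λ where
          (yes S∪j-edge) → ZBlue⇒¬¬y≈0 (others-blue j S∪j-edge j≢w) λ yj≈0 → term≉0 (trans (*-congˡ yj≈0) (zeroʳ _))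
          (no  S∪j-not-edge) → S∪j-not-edge (subst (IsEdge H) (image-snoc i j)
                                 (proj₁ (proj₂ A∈S (snoc i j)) λ Aij≈0 → term≉0 (trans (*-congʳ Aij≈0) (zeroˡ _))))

    M≤Z₀ : ∀ (A : HyperMatrix (suc k) n) → InS H A →
           ∀ (m : ℕ) (x : Fin m → Fin n → Carrier) →
           (∀ l → IsNullVector A (x l)) → LinearlyIndependent x →
           ∀ (B : Subset n) → IsZeroForcingSet H B → m ≤ ∣ B ∣
    M≤Z₀ A A∈S m x x-null x-indep B B-forcing =
      decidable-stable (m ≤? ∣ B ∣) λ m≰∣B∣ → ¬weaklyIndependent (≰⇒> m≰∣B∣) (λ l → x l ∘ enumerate B) x|B-indep
      where
      x|B-indep : WeaklyIndependent (λ l → x l ∘ enumerate B)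
      x|B-indep a a·x|B≈0 l =
        ¬¬-map (λ a·x≈0 → x-indep a a·x≈0 l)
          (¬¬-pull-Fin (λ v → ZBlue⇒¬¬y≈0 A∈S (combination-null {A = A} a x x-null) a·x|B≈0′ (B-forcing v)))
        where
        a·x|B≈0′ : ∀ v → v ∈ B → combination a x v ≈ 0#
        a·x|B≈0′ v v∈B with enumerate-surjective B v∈B
        ... | j , refl = a·x|B≈0 j

corollary2p5 : ∀ {c ℓ : Level} (F : Field c ℓ) {n k : ℕ} (H : Hypergraph n (suc k)) → 1 ≤ k →
    let open FieldDefs F in
    -- M(H) ≤ Z₀(H)
    (∀ (A : HyperMatrix (suc k) n) → InS H A →
       ∀ (m : ℕ) (x : Fin m → Fin n → Field.Carrier F) →
       (∀ l → IsNullVector A (x l)) → LinearlyIndependent x →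
       ∀ (B : Subset n) → IsZeroForcingSet H B → m ≤ ∣ B ∣) ×
    -- Z₀(H) ≤ I(H)
    (∀ (B : Subset n) → IsInfectingSet H B →
       Σ (Subset n) λ B′ → IsZeroForcingSet H B′ × ∣ B′ ∣ ≤ ∣ B ∣) ×
    -- I(H) ≤ Z_pd(H)
    (∀ (B : Subset n) → IsPdSet H B →
       Σ (Subset n) λ B′ → IsInfectingSet H B′ × ∣ B′ ∣ ≤ ∣ B ∣)
corollary2p5 F H _ =
  M≤Z₀ F H ,
  (λ B B-infecting → B , Infected⇒ZBlue ∘ B-infecting , ≤-refl) ,
  (λ B B-pd → B , PdBlue⇒Infected ∘ B-pd , ≤-refl)
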